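{- Let $p=p[1\ldots m]$ and $t=t[1\ldots n]$ be sequences of pairwise distinct integers, let $1\le j\le n-m$ and $x=t[j\ldots j+m]$ (of length $m+1$). Let $\ell=\mathrm{lcp}(\overrightarrow{PD}_p,\overrightarrow{PD}_x)$ and $r=\mathrm{lcs}(\overleftarrow{PD}_p,\overleftarrow{PD}_x)$. If $\ell+r\ge m$, then $p\overset{\textsc{INS}}{\approx}_{CT} x$.
   Context: The Cartesian tree $C(x)$ of a sequence $x$ has as root the position $g$ of its minimum, left subtree $C(x[1\ldots g-1])$ and right subtree the Cartesian tree of the part after $g$; $u\approx_{CT} v$ means $C(u)=C(v)$ (empty sequences match). $\overrightarrow{PD}_x[h]=h-\max\{k<h: x[k]<x[h]\}$ if such $k$ exists and $0$ otherwise; $\overleftarrow{PD}_x[h]=\min\{k>h: x[k]<x[h]\}-h$ if such $k$ exists and $0$ otherwise. $\mathrm{lcp}(u,v)$ and $\mathrm{lcs}(u,v)$ are the lengths of the longest common prefix and longest common suffix of sequences $u,v$ (possibly of different lengths). For $x$ of length $m$ and $y$ of length $m+1$, $x\overset{\textsc{INS}}{\approx}_{CT} y$ means there exists $h\in\{1,\ldots,m\}$ with $x[1\ldots h]\approx_{CT} y[1\ldots h]$ and $x[h+1\ldots m]\approx_{CT} y[h+2\ldots m+1]$. -}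

module Defs where

open import Data.Nat using (ℕ; zero; suc; _+_; _≤_; _<?_)
open import Data.Integer as ℤ using (ℤ)
open import Data.List using (List; []; _∷_; length; take; drop; reverse)
open import Data.Product using (Σ; _×_)
open import Relation.Binary.PropositionalEquality using (_≡_)
open import Relation.Nullary using (yes; no)

-- Cartesian tree; each node is labelled by the (1-based) position of the
-- root inside the (sub)sequence it is the Cartesian tree of.
data CTree : Set where
  leaf : CTree
  node : ℕ → CTree → CTree → CTree

-- 0-based position of the leftmost minimum of a ∷ xs
-- (helper: current best value, its index, current index)
argminFrom : ℤ → ℕ → ℕ → List ℤ → ℕ
argminFrom b bi i [] = bi
argminFrom b bi i (y ∷ ys) with y ℤ.<? b
... | yes _ = argminFrom y i (suc i) ys
... | no _ = argminFrom b bi (suc i) ys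

argmin : ℤ → List ℤ → ℕ
argmin a xs = argminFrom a 0 1 xs

-- fuel-based construction; fuel = length suffices
ctF : ℕ → List ℤ → CTree
ctF zero _ = leaf
ctF (suc f) [] = leaf
ctF (suc f) (a ∷ xs) =
  let g = argmin a xs
      ys = a ∷ xs
  in node (suc g) (ctF f (take g ys)) (ctF f (drop (suc g) ys))

C : List ℤ → CTree
C x = ctF (length x) x

_≈CT_ : List ℤ → List ℤ → Set
u ≈CT v = C u ≡ C v

-- distance to the nearest smaller element in a list scanned outward
-- (first element at distance 1); 0 if none
nearestSmaller : ℕ → List ℤ → ℤ → ℕ
nearestSmaller d [] v = 0
nearestSmaller d (y ∷ ys) v with y ℤ.<? v
... | yes _ = d
... | no _ = nearestSmaller (suc d) ys v

-- forward previous-smaller distance array; acc = reversed prefix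
PDfwdAcc : List ℤ → List ℤ → List ℕ
PDfwdAcc acc [] = []
PDfwdAcc acc (a ∷ xs) = nearestSmaller 1 acc a ∷ PDfwdAcc (a ∷ acc) xs

PDfwd : List ℤ → List ℕ
PDfwd x = PDfwdAcc [] x

PDbwd : List ℤ → List ℕ
PDbwd [] = []
PDbwd (a ∷ xs) = nearestSmaller 1 xs a ∷ PDbwd xs

lcp : List ℕ → List ℕ → ℕ
lcp [] _ = 0
lcp (_ ∷ _) [] = 0
lcp (a ∷ as) (b ∷ bs) with a Data.Nat.≟ b
... | yes _ = suc (lcp as bs)
... | no _ = 0

lcs : List ℕ → List ℕ → ℕ
lcs u v = lcp (reverse u) (reverse v)

INS≈CT : List ℤ → List ℤ → Set
INS≈CT x y = Σ ℕ λ h → (1 ≤ h) × (h ≤ length x) ×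
  (take h x ≈CT take h y) × (drop h x ≈CT drop (suc h) y)

-- substring t[j … j+m] (1-based, length m+1)
window : List ℤ → ℕ → ℕ → List ℤ
window t j m = take (suc m) (drop (j Data.Nat.∸ 1) t)

{-# OPTIONS --safe #-}
module Submission where

-- A Cartesian tree is assembled from the position of the leftmost minimum and, recursively,
-- from the same data for the parts before and after it.  So any relation between sequences
-- that is preserved by take and drop and fixes that position forces equal trees.  Equality
-- of backward PD arrays is such a relation: the leftmost minimum is the first position with
-- no smaller element to its right, and cutting a sequence only zeroes the distances that
-- leave it.  Equality of forward PD arrays is one as well for sequences of distinct
-- elements, whose minimum is the last position with no smaller element to its left.  With
-- h the lcp of the forward arrays, p[1..h] and x[1..h] thus have equal trees, and
-- lcs ≥ m - h makes the backward arrays of p[h+1..m] and x[h+2..m+1] equal.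

open import Defs
open import Data.Nat using (ℕ; _+_; _≤_; _≥_; _∸_)
open import Data.Integer using (ℤ)
open import Data.List using (List; length)
open import Data.List.Relation.Unary.Unique.Propositional using (Unique)

open import Data.Nat using (zero; suc; z≤n; s≤s; z<s; _<_; _<?_; _⊓_)
import Data.Nat.Properties as ℕ
import Data.Integer as ℤ
import Data.Integer.Properties as ℤₚ
open import Data.List using ([]; _∷_; take; drop; reverse; _++_; _ʳ++_)
open import Data.List.Properties
  using (∷-injectiveˡ; ∷-injectiveʳ; length-take; length-drop; length-reverse;
         take++drop≡id; reverse-++; reverse-injective)
open import Data.List.Membership.Propositional using (_∈_; lose)
open import Data.List.Relation.Unary.All as All using (All; []; _∷_)
open import Data.List.Relation.Unary.All.Properties using (¬Any⇒All¬)
open import Data.List.Relation.Unary.Any as Any using (Any; here; there; any?)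
open import Data.List.Relation.Unary.AllPairs using (_∷_)
open import Data.List.Relation.Unary.Unique.Propositional.Properties using (take⁺; drop⁺)
open import Data.Product using (∃; _×_; _,_)
open import Data.Sum as Sum using (_⊎_; inj₁; inj₂)
open import Function using (_∘_; flip)
open import Relation.Nullary using (yes; no; contradiction)
open import Relation.Binary.PropositionalEquality
  using (_≡_; _≢_; ≢-sym; refl; sym; trans; cong; cong₂; subst; module ≡-Reasoning)

keepBelow : ℕ → ℕ → ℕ
keepBelow n x with x <? n
... | yes _ = x
... | no _ = 0

keepBelow-< : ∀ {n x} → x < n → keepBelow n x ≡ x
keepBelow-< {n} {x} x<n with x <? n
... | yes _ = refl
... | no x≮n = contradiction x<n x≮n

keepBelow-≥ : ∀ {n x} → n ≤ x → keepBelow n x ≡ 0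
keepBelow-≥ {n} {x} n≤x with x <? n
... | yes x<n = contradiction x<n (ℕ.≤⇒≯ n≤x)
... | no _ = refl

keepBelow-zero : ∀ n → keepBelow n 0 ≡ 0
keepBelow-zero n with 0 <? n
... | yes _ = refl
... | no _ = refl

nearestSmaller≡0⊎≥ : ∀ d xs v →
  nearestSmaller d xs v ≡ 0 ⊎ d ≤ nearestSmaller d xs v
nearestSmaller≡0⊎≥ d [] v = inj₁ refl
nearestSmaller≡0⊎≥ d (y ∷ ys) v with y ℤ.<? v
... | yes _ = inj₂ ℕ.≤-refl
... | no _ = Sum.map₂ ℕ.<⇒≤ (nearestSmaller≡0⊎≥ (suc d) ys v)

nearestSmaller-take : ∀ d k xs v →
  nearestSmaller d (take k xs) v ≡ keepBelow (d + k) (nearestSmaller d xs v)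
nearestSmaller-take d zero xs v with nearestSmaller≡0⊎≥ d xs v
... | inj₁ none rewrite none = sym (keepBelow-zero (d + 0))
... | inj₂ far = sym (keepBelow-≥ (ℕ.≤-trans (ℕ.≤-reflexive (ℕ.+-identityʳ d)) far))
nearestSmaller-take d (suc k) [] v = sym (keepBelow-zero (d + suc k))
nearestSmaller-take d (suc k) (y ∷ ys) v with y ℤ.<? v
... | yes _ = sym (keepBelow-< (ℕ.m<m+n d z<s))
... | no _ = trans (nearestSmaller-take (suc d) k ys v)
                   (cong (λ n → keepBelow n (nearestSmaller (suc d) ys v)) (sym (ℕ.+-suc d k)))

nearestSmaller-take-cong : ∀ d k {xs ys v w} →
  nearestSmaller d xs v ≡ nearestSmaller d ys w →
  nearestSmaller d (take k xs) v ≡ nearestSmaller d (take k ys) w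
nearestSmaller-take-cong d k {xs} {ys} {v} {w} eq =
  trans (nearestSmaller-take d k xs v)
        (trans (cong (keepBelow (d + k)) eq) (sym (nearestSmaller-take d k ys w)))

nearestSmaller-all : ∀ d {v xs} → All (v ℤ.≤_) xs → nearestSmaller d xs v ≡ 0
nearestSmaller-all d [] = refl
nearestSmaller-all d {v} {y ∷ _} (v≤y ∷ v≤ys) with y ℤ.<? v
... | yes y<v = contradiction y<v (ℤₚ.≤⇒≯ v≤y)
... | no _ = nearestSmaller-all (suc d) v≤ys

nearestSmaller-any : ∀ d {v xs} → Any (ℤ._< v) xs →
  ∃ λ n → nearestSmaller (suc d) xs v ≡ suc n
nearestSmaller-any d {v} {y ∷ _} some<v with y ℤ.<? v
... | yes _ = d , refl
... | no y≮v = nearestSmaller-any (suc d) (Any.tail y≮v some<v)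

all≤⊎any< : ∀ v xs → All (v ℤ.≤_) xs ⊎ Any (ℤ._< v) xs
all≤⊎any< v xs with any? (λ y → y ℤ.<? v) xs
... | yes some<v = inj₂ some<v
... | no none<v = inj₁ (All.map ℤₚ.≮⇒≥ (¬Any⇒All¬ xs none<v))

module ArgminCongruence
  (_∼_ : List ℤ → List ℤ → Set)
  (∼-length : ∀ {u v} → u ∼ v → length u ≡ length v)
  (∼-argmin : ∀ {a xs b ys} → (a ∷ xs) ∼ (b ∷ ys) → argmin a xs ≡ argmin b ys)
  (∼-take : ∀ k {u v} → u ∼ v → take k u ∼ take k v)
  (∼-drop : ∀ k {u v} → u ∼ v → drop k u ∼ drop k v)
  where

  ctF-cong : ∀ f {u v} → u ∼ v → ctF f u ≡ ctF f v
  ctF-cong zero _ = refl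
  ctF-cong (suc f) {[]} {[]} _ = refl
  ctF-cong (suc f) {[]} {_ ∷ _} u∼v with () ← ∼-length u∼v
  ctF-cong (suc f) {_ ∷ _} {[]} u∼v with () ← ∼-length u∼v
  ctF-cong (suc f) {a ∷ xs} {b ∷ ys} u∼v rewrite ∼-argmin u∼v =
    cong₂ (node _) (ctF-cong f (∼-take g u∼v)) (ctF-cong f (∼-drop (suc g) u∼v))
    where g = argmin b ys

  ∼⇒≈CT : ∀ {u v} → u ∼ v → u ≈CT v
  ∼⇒≈CT {u} {v} u∼v rewrite ∼-length u∼v = ctF-cong (length v) u∼v

length-PDbwd : ∀ u → length (PDbwd u) ≡ length u
length-PDbwd [] = refl
length-PDbwd (_ ∷ u) = cong suc (length-PDbwd u)

PDbwd-drop : ∀ k u → PDbwd (drop k u) ≡ drop k (PDbwd u)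
PDbwd-drop zero u = refl
PDbwd-drop (suc k) [] = refl
PDbwd-drop (suc k) (_ ∷ u) = PDbwd-drop k u

PDbwd-take-cong : ∀ k {u v} → PDbwd u ≡ PDbwd v → PDbwd (take k u) ≡ PDbwd (take k v)
PDbwd-take-cong zero _ = refl
PDbwd-take-cong (suc k) {[]} {[]} _ = refl
PDbwd-take-cong (suc k) {_ ∷ _} {_ ∷ _} eq =
  cong₂ _∷_ (nearestSmaller-take-cong 1 k (∷-injectiveˡ eq))
            (PDbwd-take-cong k (∷-injectiveʳ eq))

firstZero : List ℕ → ℕ
firstZero [] = 0
firstZero (zero ∷ _) = 0
firstZero (suc _ ∷ ns) = suc (firstZero ns)

argminFrom-all : ∀ {b} bi i {ys} → All (b ℤ.≤_) ys → argminFrom b bi i ys ≡ bi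
argminFrom-all bi i [] = refl
argminFrom-all {b} bi i {y ∷ _} (b≤y ∷ b≤ys) with y ℤ.<? b
... | yes y<b = contradiction y<b (ℤₚ.≤⇒≯ b≤y)
... | no _ = argminFrom-all bi (suc i) b≤ys

mutual
  argminFrom-fresh : ∀ y i ys → argminFrom y i (suc i) ys ≡ i + firstZero (PDbwd (y ∷ ys))
  argminFrom-fresh y i ys with all≤⊎any< y ys
  ... | inj₁ y≤ys rewrite nearestSmaller-all 1 y≤ys =
    trans (argminFrom-all i (suc i) y≤ys) (sym (ℕ.+-identityʳ i))
  ... | inj₂ some<y with _ , eq ← nearestSmaller-any 0 some<y rewrite eq =
    trans (argminFrom-any i (suc i) some<y) (sym (ℕ.+-suc i _))

  argminFrom-any : ∀ {b} bi i {ys} → Any (ℤ._< b) ys →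
                   argminFrom b bi i ys ≡ i + firstZero (PDbwd ys)
  argminFrom-any {b} bi i {y ∷ ys} some<b with y ℤ.<? b | some<b
  ... | yes _ | _ = argminFrom-fresh y i ys
  ... | no y≮b | here y<b = contradiction y<b y≮b
  ... | no y≮b | there ys<b
      with _ , eq ← nearestSmaller-any 0 (Any.map (flip ℤₚ.<-≤-trans (ℤₚ.≮⇒≥ y≮b)) ys<b)
      rewrite eq =
    trans (argminFrom-any bi (suc i) ys<b) (sym (ℕ.+-suc i _))

argmin≡firstZero-PDbwd : ∀ a xs → argmin a xs ≡ firstZero (PDbwd (a ∷ xs))
argmin≡firstZero-PDbwd a xs = argminFrom-fresh a 0 xs

PDbwd⇒≈CT : ∀ {u v} → PDbwd u ≡ PDbwd v → u ≈CT v
PDbwd⇒≈CT = ArgminCongruence.∼⇒≈CT (λ u v → PDbwd u ≡ PDbwd v)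
  (λ {u} {v} eq → trans (sym (length-PDbwd u)) (trans (cong length eq) (length-PDbwd v)))
  (λ {a} {xs} {b} {ys} eq → trans (argmin≡firstZero-PDbwd a xs)
     (trans (cong firstZero eq) (sym (argmin≡firstZero-PDbwd b ys))))
  PDbwd-take-cong
  (λ k {u} {v} eq → trans (PDbwd-drop k u) (trans (cong (drop k) eq) (sym (PDbwd-drop k v))))

length-PDfwdAcc : ∀ acc u → length (PDfwdAcc acc u) ≡ length u
length-PDfwdAcc acc [] = refl
length-PDfwdAcc acc (y ∷ u) = cong suc (length-PDfwdAcc (y ∷ acc) u)

PDfwdAcc-take : ∀ k acc u → PDfwdAcc acc (take k u) ≡ take k (PDfwdAcc acc u)
PDfwdAcc-take zero acc u = refl
PDfwdAcc-take (suc k) acc [] = refl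
PDfwdAcc-take (suc k) acc (y ∷ u) = cong (_ ∷_) (PDfwdAcc-take k (y ∷ acc) u)

PDfwdAcc-drop : ∀ k acc u → drop k (PDfwdAcc acc u) ≡ PDfwdAcc (take k u ʳ++ acc) (drop k u)
PDfwdAcc-drop zero acc u = refl
PDfwdAcc-drop (suc k) acc [] = refl
PDfwdAcc-drop (suc k) acc (y ∷ u) = PDfwdAcc-drop k (y ∷ acc) u

PDfwdAcc-take-cong : ∀ k {acc acc′ u v} → PDfwdAcc acc u ≡ PDfwdAcc acc′ v →
                     PDfwdAcc (take k acc) u ≡ PDfwdAcc (take k acc′) v
PDfwdAcc-take-cong k {u = []} {[]} _ = refl
PDfwdAcc-take-cong k {u = _ ∷ _} {_ ∷ _} eq =
  cong₂ _∷_ (nearestSmaller-take-cong 1 k (∷-injectiveˡ eq))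
            (PDfwdAcc-take-cong (suc k) (∷-injectiveʳ eq))

PDfwd-drop-cong : ∀ k {u v} → PDfwd u ≡ PDfwd v → PDfwd (drop k u) ≡ PDfwd (drop k v)
PDfwd-drop-cong k {u} {v} eq = PDfwdAcc-take-cong 0
  (trans (sym (PDfwdAcc-drop k [] u)) (trans (cong (drop k) eq) (PDfwdAcc-drop k [] v)))

lastZeroFrom : ℕ → ℕ → List ℕ → ℕ
lastZeroFrom z i [] = z
lastZeroFrom z i (zero ∷ ns) = lastZeroFrom i (suc i) ns
lastZeroFrom z i (suc _ ∷ ns) = lastZeroFrom z (suc i) ns

lastZero : List ℕ → ℕ
lastZero = lastZeroFrom 0 0

distinct-∷ : ∀ {A : Set} {y : A} {acc ys} →
             All (y ≢_) ys → All (λ z → All (z ≢_) acc) ys →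
             All (λ z → All (z ≢_) (y ∷ acc)) ys
distinct-∷ y≢ys ys≢acc =
  All.zipWith (λ (y≢z , z≢acc) → ≢-sym y≢z ∷ z≢acc) (y≢ys , ys≢acc)

-- acc is the prefix read so far, reversed, with minimum b; by distinctness a new element y
-- has no smaller element in acc exactly when y < b.
argminFrom≡lastZeroFrom : ∀ {b acc} bi i {ys} → b ∈ acc → All (b ℤ.≤_) acc →
  Unique ys → All (λ y → All (y ≢_) acc) ys →
  argminFrom b bi i ys ≡ lastZeroFrom bi i (PDfwdAcc acc ys)
argminFrom≡lastZeroFrom bi i {[]} _ _ _ _ = refl
argminFrom≡lastZeroFrom {b} {acc} bi i {y ∷ ys}
  b∈acc b≤acc (y≢ys ∷ ys-unique) (y≢acc ∷ ys≢acc) with y ℤ.<? b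
... | yes y<b with y≤acc ← All.map (ℤₚ.<⇒≤ ∘ ℤₚ.<-≤-trans y<b) b≤acc
  rewrite nearestSmaller-all 1 y≤acc =
  argminFrom≡lastZeroFrom i (suc i) (here refl) (ℤₚ.≤-refl ∷ y≤acc)
    ys-unique (distinct-∷ y≢ys ys≢acc)
... | no y≮b with b≤y ← ℤₚ.≮⇒≥ y≮b
  with b<y ← ℤₚ.≤∧≢⇒< b≤y (≢-sym (All.lookup y≢acc b∈acc))
  with _ , eq ← nearestSmaller-any 0 (lose b∈acc b<y)
  rewrite eq =
  argminFrom≡lastZeroFrom bi (suc i) (there b∈acc) (b≤y ∷ b≤acc)
    ys-unique (distinct-∷ y≢ys ys≢acc)

argmin≡lastZero-PDfwd : ∀ {a xs} → Unique (a ∷ xs) →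
                        argmin a xs ≡ lastZero (PDfwd (a ∷ xs))
argmin≡lastZero-PDfwd (a≢xs ∷ xs-unique) =
  argminFrom≡lastZeroFrom 0 1 (here refl) (ℤₚ.≤-refl ∷ []) xs-unique
    (All.map (λ a≢z → ≢-sym a≢z ∷ []) a≢xs)

SamePDfwd : List ℤ → List ℤ → Set
SamePDfwd u v = Unique u × Unique v × PDfwd u ≡ PDfwd v

PDfwd⇒≈CT : ∀ {u v} → Unique u → Unique v → PDfwd u ≡ PDfwd v → u ≈CT v
PDfwd⇒≈CT u-unique v-unique eq = ArgminCongruence.∼⇒≈CT SamePDfwd
  (λ {u} {v} (_ , _ , eq) → trans (sym (length-PDfwdAcc [] u))
                                  (trans (cong length eq) (length-PDfwdAcc [] v)))
  (λ (u-unique , v-unique , eq) → trans (argmin≡lastZero-PDfwd u-unique)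
     (trans (cong lastZero eq) (sym (argmin≡lastZero-PDfwd v-unique))))
  (λ k {u} {v} (u-unique , v-unique , eq) → take⁺ k u-unique , take⁺ k v-unique ,
     trans (PDfwdAcc-take k [] u) (trans (cong (take k) eq) (sym (PDfwdAcc-take k [] v))))
  (λ k (u-unique , v-unique , eq) →
     drop⁺ k u-unique , drop⁺ k v-unique , PDfwd-drop-cong k eq)
  (u-unique , v-unique , eq)

lcp≤length : ∀ as bs → lcp as bs ≤ length as
lcp≤length [] _ = z≤n
lcp≤length (_ ∷ _) [] = z≤n
lcp≤length (a ∷ as) (b ∷ bs) with a ℕ.≟ b
... | yes _ = s≤s (lcp≤length as bs)
... | no _ = z≤n

lcp-take : ∀ k {as bs} → k ≤ lcp as bs → take k as ≡ take k bs
lcp-take zero _ = refl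
lcp-take (suc k) {a ∷ as} {b ∷ bs} k<lcp with a ℕ.≟ b | k<lcp
... | yes refl | s≤s k≤lcp = cong (a ∷_) (lcp-take k k≤lcp)

take-++-exact : ∀ {A : Set} {k} (xs ys : List A) → length xs ≡ k → take k (xs ++ ys) ≡ xs
take-++-exact [] ys refl = refl
take-++-exact (x ∷ xs) ys refl = cong (x ∷_) (take-++-exact xs ys refl)

take-reverse : ∀ {A : Set} i k (as : List A) → length as ≡ i + k →
               take k (reverse as) ≡ reverse (drop i as)
take-reverse i k as len-as = begin
  take k (reverse as)                    ≡⟨ cong (take k ∘ reverse) (take++drop≡id i as) ⟨
  take k (reverse (front ++ back))       ≡⟨ cong (take k) (reverse-++ front back) ⟩
  take k (reverse back ++ reverse front) ≡⟨ take-++-exact (reverse back) _ reverse-back-length ⟩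
  reverse back                           ∎
  where
  open ≡-Reasoning
  front = take i as
  back = drop i as
  reverse-back-length : length (reverse back) ≡ k
  reverse-back-length = begin
    length (reverse back) ≡⟨ length-reverse back ⟩
    length back           ≡⟨ length-drop i as ⟩
    length as ∸ i         ≡⟨ cong (_∸ i) len-as ⟩
    i + k ∸ i             ≡⟨ ℕ.m+n∸m≡n i k ⟩
    k                     ∎

lcs-drop : ∀ (as bs : List ℕ) i j k → length as ≡ i + k → length bs ≡ j + k →
           k ≤ lcs as bs → drop i as ≡ drop j bs
lcs-drop as bs i j k len-as len-bs k≤lcs = reverse-injective (begin
  reverse (drop i as) ≡⟨ take-reverse i k as len-as ⟨
  take k (reverse as) ≡⟨ lcp-take k k≤lcs ⟩
  take k (reverse bs) ≡⟨ take-reverse j k bs len-bs ⟩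
  reverse (drop j bs) ∎)
  where open ≡-Reasoning

lcp+lcs≥length⇒INS≈CT : ∀ p x → Unique p → Unique x →
  length x ≡ suc (length p) → 1 ≤ length p →
  lcp (PDfwd p) (PDfwd x) + lcs (PDbwd p) (PDbwd x) ≥ length p → INS≈CT p x
lcp+lcs≥length⇒INS≈CT p@(_ ∷ _) x@(_ ∷ _) p-unique x-unique x≡m+1 _ lcp+lcs≥m =
  -- both forward arrays start with 0, hence 1 ≤ h
  h , s≤s z≤n , h≤m , prefix≈ , suffix≈
  where
  open ≡-Reasoning
  m = length p
  h = lcp (PDfwd p) (PDfwd x)

  h≤m : h ≤ m
  h≤m = subst (h ≤_) (length-PDfwdAcc [] p) (lcp≤length (PDfwd p) (PDfwd x))

  prefix≈ : take h p ≈CT take h x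
  prefix≈ = PDfwd⇒≈CT (take⁺ h p-unique) (take⁺ h x-unique) (begin
    PDfwd (take h p) ≡⟨ PDfwdAcc-take h [] p ⟩
    take h (PDfwd p) ≡⟨ lcp-take h ℕ.≤-refl ⟩
    take h (PDfwd x) ≡⟨ PDfwdAcc-take h [] x ⟨
    PDfwd (take h x) ∎)

  PDbwd-p-length : length (PDbwd p) ≡ h + (m ∸ h)
  PDbwd-p-length = trans (length-PDbwd p) (sym (ℕ.m+[n∸m]≡n h≤m))

  PDbwd-x-length : length (PDbwd x) ≡ suc h + (m ∸ h)
  PDbwd-x-length = trans (length-PDbwd x) (trans x≡m+1 (cong suc (sym (ℕ.m+[n∸m]≡n h≤m))))

  suffix≈ : drop h p ≈CT drop (suc h) x
  suffix≈ = PDbwd⇒≈CT (begin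
    PDbwd (drop h p)       ≡⟨ PDbwd-drop h p ⟩
    drop h (PDbwd p)       ≡⟨ lcs-drop (PDbwd p) (PDbwd x) h (suc h) (m ∸ h)
                                PDbwd-p-length PDbwd-x-length (ℕ.m≤n+o⇒m∸n≤o m h lcp+lcs≥m) ⟩
    drop (suc h) (PDbwd x) ≡⟨ PDbwd-drop (suc h) x ⟨
    PDbwd (drop (suc h) x) ∎)

length-window : ∀ t j m → 1 ≤ j → j ≤ length t ∸ m → length (window t j m) ≡ suc m
length-window t (suc j) m _ j<n∸m = begin
  length (take (suc m) (drop j t)) ≡⟨ length-take (suc m) (drop j t) ⟩
  suc m ⊓ length (drop j t)        ≡⟨ cong (suc m ⊓_) (length-drop j t) ⟩
  suc m ⊓ (length t ∸ j)           ≡⟨ ℕ.m≤n⇒m⊓n≡m fits ⟩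
  suc m                            ∎
  where
  open ≡-Reasoning
  m<n : m < length t
  m<n = ℕ.m∸n≢0⇒n<m (≢-sym (ℕ.<⇒≢ (ℕ.<-≤-trans z<s j<n∸m)))
  fits : suc m ≤ length t ∸ j
  fits = ℕ.m+n≤o⇒m≤o∸n (suc m)
    (subst (_≤ length t) (cong suc (ℕ.+-comm j m))
           (ℕ.m≤o∸n⇒m+n≤o (suc j) (ℕ.<⇒≤ m<n) j<n∸m))

lemma22 : (p t : List ℤ) → Unique p → Unique t → 1 ≤ length p →
          (j : ℕ) → 1 ≤ j → j ≤ length t ∸ length p →
          lcp (PDfwd p) (PDfwd (window t j (length p)))
            + lcs (PDbwd p) (PDbwd (window t j (length p))) ≥ length p →
          INS≈CT p (window t j (length p))
lemma22 p t p-unique t-unique 1≤m j 1≤j j≤n∸m lcp+lcs≥m =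
  lcp+lcs≥length⇒INS≈CT p (window t j (length p)) p-unique
    (take⁺ (suc (length p)) (drop⁺ (j ∸ 1) t-unique))
    (length-window t j (length p) 1≤j j≤n∸m) 1≤m lcp+lcs≥m
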